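{- Let $\mathcal L=(X,\succeq)$ be a finite lattice with partial representation $(B,\succeq_B)$ and partial representation function $\psi$, let $\mathcal L^c=(X,\preceq)$, and let $\psi^c(x)=B\setminus\psi(x)$. Assume that every element $x\in X$ satisfies a join constraint $(\alpha,\beta)$ on $B$ (i.e., $\alpha(\psi(x))=1$ implies $\beta(\psi(x))=1$). Then $\psi^c$ is a partial representation function for $\mathcal L^c$. Furthermore, every $x\in X$ satisfies $\beta^c(\psi^c(x))=1$ only if $\alpha^c(\psi^c(x))=1$, where $(\beta^c,\alpha^c)$ is the complement of $(\alpha,\beta)$.
   Context: $\mathcal D(B)$ is the set of lower closed subsets of a poset $B$. A poset $(B,\succeq_B)$ is a partial representation of a lattice $(X,\succeq)$ if there is an order-embedding $\psi$ (i.e. $x\succeq x'\iff\psi(x)\supseteq\psi(x')$) of $(X,\succeq)$ into $(\mathcal D(B),\supseteq)$ mapping the maximum to $B$ and the minimum to $\emptyset$; $\psi$ is a partial representation function. For the complement lattice $(X,\preceq)$, partial representation is with respect to the poset $(B,\preceq_B)$. A join constraint on $B$ is a pair $(\alpha,\beta)$ of maps $2^B\to\{0,1\}$, $\alpha(T)=(\mathbf 1_{b_{11}}(T)\vee\mathbf 1_{b_{12}}(T)\vee\cdots)\wedge(\mathbf 1_{b_{21}}(T)\vee\mathbf 1_{b_{22}}(T)\vee\cdots)\wedge\cdots$, $\beta(T)=\mathbf 1_{b_1}(T)\wedge\mathbf 1_{b_2}(T)\wedge\cdots$, with $b_{ik},b_i\in B$ and $b_{i_1i_2}\not\prec_B b_{i_3i_4}$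 for all indices; $\mathbf 1_b(T)$ indicates $b\in T$. Its complement $(\beta^c,\alpha^c)$ is $\beta^c(T)=\mathbf 1_{b_1}(T)\vee\mathbf 1_{b_2}(T)\vee\cdots$ and $\alpha^c(T)=(\mathbf 1_{b_{11}}(T)\wedge\mathbf 1_{b_{12}}(T)\wedge\cdots)\vee(\mathbf 1_{b_{21}}(T)\wedge\mathbf 1_{b_{22}}(T)\wedge\cdots)\vee\cdots$. -}

module Defs where

open import Level using (0ℓ)
open import Data.Bool using (Bool; true; false; not)
open import Data.List using (List)
open import Data.Bool.ListAction using (all; any)
open import Data.List.Membership.Propositional using (_∈_)
open import Data.List.Relation.Unary.Any using (Any)
open import Data.Product using (Σ; _×_)
open import Relation.Binary using (Rel)
open import Relation.Binary.PropositionalEquality using (_≡_)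
open import Relation.Nullary using (¬_)
open import Function.Bundles using (_⇔_)
open import Relation.Binary.Lattice.Bundles using (Lattice)

Subset : Set → Set
Subset B = B → Bool

_⊇_ : {B : Set} → Subset B → Subset B → Set
T ⊇ T' = ∀ b → T' b ≡ true → T b ≡ true

LowerClosed : {B : Set} → Rel B 0ℓ → Subset B → Set
LowerClosed _≥B_ T = ∀ b b' → b ≥B b' → T b ≡ true → T b' ≡ true

record IsPartialRepFn {X B : Set} (_≥X_ : Rel X 0ℓ) (_≥B_ : Rel B 0ℓ)
                      (ψ : X → Subset B) : Set where
  field
    lowerClosed : ∀ x → LowerClosed _≥B_ (ψ x)
    embedding   : ∀ x x' → (x ≥X x') ⇔ (ψ x ⊇ ψ x')
    maxToB      : ∀ x → (∀ y → x ≥X y) → ∀ b → ψ x b ≡ true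
    minToEmpty  : ∀ x → (∀ y → y ≥X x) → ∀ b → ψ x b ≡ false

IsFiniteLattice : Lattice 0ℓ 0ℓ 0ℓ → Set
IsFiniteLattice L = Σ (List Carrier) λ xs → ∀ x → Any (x ≈_) xs
  where open Lattice L

-- A join constraint (α, β) on B: α is a conjunction of clauses, each clause a
-- disjunction of membership literals; β is a conjunction of membership literals.
record JoinConstraint (B : Set) : Set where
  constructor jc
  field
    αclauses : List (List B)
    βatoms   : List B

αfun : {B : Set} → JoinConstraint B → Subset B → Bool
αfun c T = all (λ cl → any T cl) (JoinConstraint.αclauses c)

βfun : {B : Set} → JoinConstraint B → Subset B → Bool
βfun c T = all T (JoinConstraint.βatoms c)

βcfun : {B : Set} → JoinConstraint B → Subset B → Bool
βcfun c T = any T (JoinConstraint.βatoms c)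

αcfun : {B : Set} → JoinConstraint B → Subset B → Bool
αcfun c T = any (λ cl → all T cl) (JoinConstraint.αclauses c)

_≺[_]_ : {B : Set} → B → Rel B 0ℓ → B → Set
b ≺[ _≥B_ ] b' = (b' ≥B b) × ¬ (b ≡ b')

WellFormedJC : {B : Set} → Rel B 0ℓ → JoinConstraint B → Set
WellFormedJC _≥B_ c =
  ∀ {cl cl' b b'} → cl ∈ JoinConstraint.αclauses c → b ∈ cl →
    cl' ∈ JoinConstraint.αclauses c → b' ∈ cl' → ¬ (b ≺[ _≥B_ ] b')

Satisfies : {B : Set} → JoinConstraint B → Subset B → Set
Satisfies c T = αfun c T ≡ true → βfun c T ≡ true

complementFn : {X B : Set} → (X → Subset B) → X → Subset B
complementFn ψ x b = not (ψ x b)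

{-# OPTIONS --safe #-}
module Submission where

open import Defs
open import Level using (0ℓ)
open import Data.Bool using (Bool; true; false; not; _∧_; _∨_)
open import Data.Bool.ListAction using (all; any; or)
open import Data.Bool.Properties using (∨-∧-booleanAlgebra)
open import Algebra.Lattice.Properties.BooleanAlgebra ∨-∧-booleanAlgebra
  using (deMorgan₁; deMorgan₂)
open import Data.List using (List; []; _∷_)
open import Data.List.Properties using (map-cong)
open import Data.Product using (_×_; _,_)
open import Relation.Binary using (Rel; IsPartialOrder)
open import Relation.Binary.PropositionalEquality
  using (_≡_; _≗_; refl; sym; cong; module ≡-Reasoning)
open import Relation.Binary.Lattice.Bundles using (Lattice)
open import Function using (flip; _∘_; id)
open import Function.Bundles using (_⇔_; mk⇔; Equivalence)
open import Function.Construct.Composition using (_⇔-∘_)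

-- Complementation turns ψ(x) ⊇ ψ(x') into ψᶜ(x') ⊇ ψᶜ(x) and turns a lower set of
-- (B, ≥B) into a lower set of (B, ≤B), which gives the first claim; the second is
-- De Morgan's law applied to the formulas α and β.

contraposeᵇ : ∀ a b → (a ≡ true → b ≡ true) ⇔ (not b ≡ true → not a ≡ true)
contraposeᵇ false b     = mk⇔ (λ _ _ → refl) (λ _ ())
contraposeᵇ true  true  = mk⇔ (λ _ ()) (λ _ _ → refl)
contraposeᵇ true  false = mk⇔ id id

module _ {B : Set} where

  ⊇-complement : (T T' : Subset B) → T ⊇ T' ⇔ (not ∘ T') ⊇ (not ∘ T)
  ⊇-complement T T' = mk⇔
    (λ T⊇T' b → Equivalence.to (contraposeᵇ (T' b) (T b)) (T⊇T' b))
    (λ Tᶜ⊇T'ᶜ b → Equivalence.from (contraposeᵇ (T' b) (T b)) (Tᶜ⊇T'ᶜ b))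

  lowerClosed-complement : {_≥B_ : Rel B 0ℓ} {T : Subset B} →
    LowerClosed _≥B_ T → LowerClosed (flip _≥B_) (not ∘ T)
  lowerClosed-complement {T = T} closed b b' b'≥b =
    Equivalence.to (contraposeᵇ (T b') (T b)) (closed b' b b'≥b)

complement-isPartialRepFn : {X B : Set} {_≥X_ : Rel X 0ℓ} {_≥B_ : Rel B 0ℓ}
  {ψ : X → Subset B} → IsPartialRepFn _≥X_ _≥B_ ψ →
  IsPartialRepFn (flip _≥X_) (flip _≥B_) (complementFn ψ)
complement-isPartialRepFn {ψ = ψ} rep = record
  { lowerClosed = λ x → lowerClosed-complement (lowerClosed x)
  ; embedding   = λ x x' → ⊇-complement (ψ x') (ψ x) ⇔-∘ embedding x' x
  ; maxToB      = λ x x-max b → cong not (minToEmpty x x-max b)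
  ; minToEmpty  = λ x x-min b → cong not (maxToB x x-min b)
  }
  where open IsPartialRepFn rep

module _ {A : Set} where

  any-cong : {p q : A → Bool} → p ≗ q → any p ≗ any q
  any-cong p≗q = cong or ∘ map-cong p≗q

  not-all : (p : A → Bool) (xs : List A) → not (all p xs) ≡ any (not ∘ p) xs
  not-all p []       = refl
  not-all p (x ∷ xs) = begin
    not (p x ∧ all p xs)          ≡⟨ deMorgan₁ (p x) (all p xs) ⟩
    not (p x) ∨ not (all p xs)    ≡⟨ cong (not (p x) ∨_) (not-all p xs) ⟩
    not (p x) ∨ any (not ∘ p) xs  ∎
    where open ≡-Reasoning

  not-any : (p : A → Bool) (xs : List A) → not (any p xs) ≡ all (not ∘ p) xs
  not-any p []       = refl
  not-any p (x ∷ xs) = begin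
    not (p x ∨ any p xs)          ≡⟨ deMorgan₂ (p x) (any p xs) ⟩
    not (p x) ∧ not (any p xs)    ≡⟨ cong (not (p x) ∧_) (not-any p xs) ⟩
    not (p x) ∧ all (not ∘ p) xs  ∎
    where open ≡-Reasoning

module _ {B : Set} (c : JoinConstraint B) (T : Subset B) where
  open JoinConstraint c

  βcfun-complement : βcfun c (not ∘ T) ≡ not (βfun c T)
  βcfun-complement = sym (not-all T βatoms)

  αcfun-complement : αcfun c (not ∘ T) ≡ not (αfun c T)
  αcfun-complement = begin
    any (all (not ∘ T)) αclauses  ≡⟨ any-cong (sym ∘ not-any T) αclauses ⟩
    any (not ∘ any T) αclauses    ≡⟨ not-all (any T) αclauses ⟨
    not (all (any T) αclauses)    ∎
    where open ≡-Reasoning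

SatisfiesComplement : {B : Set} → JoinConstraint B → Subset B → Set
SatisfiesComplement c T = βcfun c T ≡ true → αcfun c T ≡ true

Satisfies⇒SatisfiesComplement : {B : Set} (c : JoinConstraint B) (T : Subset B) →
  Satisfies c T → SatisfiesComplement c (not ∘ T)
Satisfies⇒SatisfiesComplement c T sat
  rewrite βcfun-complement c T | αcfun-complement c T =
  Equivalence.to (contraposeᵇ (αfun c T) (βfun c T)) sat

lemma10 : (L : Lattice 0ℓ 0ℓ 0ℓ) → IsFiniteLattice L →
    (B : Set) (_≥B_ : Rel B 0ℓ) → IsPartialOrder _≡_ _≥B_ →
    (ψ : Lattice.Carrier L → Subset B) →
    IsPartialRepFn (flip (Lattice._≤_ L)) _≥B_ ψ →
    (c : JoinConstraint B) → WellFormedJC _≥B_ c →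
    (∀ x → Satisfies c (ψ x)) →
    IsPartialRepFn (Lattice._≤_ L) (flip _≥B_) (complementFn ψ)
      × (∀ x → βcfun c (complementFn ψ x) ≡ true → αcfun c (complementFn ψ x) ≡ true)
lemma10 _ _ _ _ _ ψ rep c _ sat =
  complement-isPartialRepFn rep , λ x → Satisfies⇒SatisfiesComplement c (ψ x) (sat x)
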